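{- Let $\psi$ be a formula and $z$ an individual variable. For every set $V$ of individual variables with $z\in V$, one can effectively produce a natural number $N$ and two sequences of formulae $(L_j)_{j<N}$ and $(R_j)_{j<N}$ such that: \begin{itemize} \item for every $j<N$, $\mathrm{FV}^{\mathrm{ind}}(L_j)\subseteq\mathrm{FV}^{\mathrm{ind}}(\psi)\cap V$ and $\mathrm{FV}^{\mathrm{ind}}(R_j)\subseteq\mathrm{FV}^{\mathrm{ind}}(\psi)\setminus V$; \item if $\mathrm{FV}^{\mathrm{ind}}(\psi)=\{\vec x,z,\vec y\}$ with $V\cap\mathrm{FV}^{\mathrm{ind}}(\psi)=\{\vec x,z\}$, then for all $n\in\mathbb N$, all $\vec a$ with each $a_i\leq n$ and all $\vec b$ with each $b_i>n$, \[\mathfrak N\models\ \psi[\vec a/\vec x,n/z,\vec b/\vec y]\ \leftrightarrow\ \bigvee_{j<N}\Big(L_j[\vec a/\vec x,n/z]|[-\leq n]\ \wedge\ R_j[\vec b/\vec y]|[->n]\Big).\] \end{itemize}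
   Context: \emph{Language.} Two-sorted: individual variables, predicate variables. Atoms: $x\doteq y$, $x\leq y$, $\mathsf S(x,y)$, $\mathsf{Zero}(x)$, $x\in X$, $\top,\bot$. Formulae $\varphi::=\alpha\mid\varphi\wedge\psi\mid\lnot\varphi\mid\exists x\varphi\mid\exists X\varphi$; $\varphi\vee\psi:=\lnot(\lnot\varphi\wedge\lnot\psi)$, $\varphi\leftrightarrow\psi$ as usual. $\mathrm{FV}^{\mathrm{ind}}(\varphi)$ is the set of free individual variables of $\varphi$. Standard model $\mathfrak N$: individuals in $\mathbb N$, predicates subsets of $\mathbb N$, $\mathsf S$ successor, $\mathsf{Zero}(x)$ iff $x=0$; the displayed equivalence is required for every assignment of subsets of $\mathbb N$ to the free predicate variables. Relativization $\varphi|[-\leq n]$ (resp. $\varphi|[->n]$): atoms unchanged, commutes with $\wedge,\lnot,\exists X$, and $\exists x\varphi$ becomes $\exists x(x\leq n\wedge\varphi|[-\leq n])$ (resp. $\exists x(x>n\wedge\varphi|[->n])$). -}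

module Defs where

open import Level using (Level; 0ℓ; Lift) renaming (suc to lsuc)
open import Data.Nat using (ℕ; zero; suc; _≤_; _≡ᵇ_; _≟_)
open import Data.Bool using (if_then_else_)
open import Data.List using (List; []; _∷_; _++_; filter)
open import Data.Unit using (⊤)
open import Data.Empty using (⊥)
open import Data.Product using (Σ; _×_)
open import Relation.Nullary using (¬_; ¬?)
open import Relation.Unary using (Pred)
open import Relation.Binary.PropositionalEquality using (_≡_)

-- Individual variables and predicate variables are both named by natural numbers
-- (two disjoint sorts of names: the constructors below fix which sort each
-- position uses).

infixr 6 _∧′_

data Formula : Set where
  _≐_  : ℕ → ℕ → Formula
  _≤′_ : ℕ → ℕ → Formula
  S′   : ℕ → ℕ → Formula
  Zero : ℕ → Formula
  _∈′_ : ℕ → ℕ → Formula          -- x ∈ X   (x individual, X predicate variable)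
  ⊤′ ⊥′ : Formula
  _∧′_ : Formula → Formula → Formula
  ¬′_  : Formula → Formula
  ∃ᵢ   : ℕ → Formula → Formula
  ∃ₚ   : ℕ → Formula → Formula

_∨′_ : Formula → Formula → Formula
φ ∨′ ψ = ¬′ ((¬′ φ) ∧′ (¬′ ψ))

FVi : Formula → List ℕ
FVi (x ≐ y)  = x ∷ y ∷ []
FVi (x ≤′ y) = x ∷ y ∷ []
FVi (S′ x y) = x ∷ y ∷ []
FVi (Zero x) = x ∷ []
FVi (x ∈′ X) = x ∷ []
FVi ⊤′ = []
FVi ⊥′ = []
FVi (φ ∧′ ψ) = FVi φ ++ FVi ψ
FVi (¬′ φ) = FVi φ
FVi (∃ᵢ x φ) = filter (λ y → ¬? (y ≟ x)) (FVi φ)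
FVi (∃ₚ X φ) = FVi φ

_[_↦_] : ∀ {a} {A : Set a} → (ℕ → A) → ℕ → A → (ℕ → A)
(f [ x ↦ a ]) y = if y ≡ᵇ x then a else f y

-- Satisfaction in the standard model 𝔑, relativized to a domain D ⊆ ℕ for the
-- individual quantifiers (predicate quantifiers range over all subsets of ℕ and
-- atoms are unchanged, as in the paper's definition of relativization).
-- σ : individual assignment, ρ : predicate assignment (subsets of ℕ).
Sat : (D : Pred ℕ 0ℓ) → (ℕ → ℕ) → (ℕ → Pred ℕ 0ℓ) → Formula → Set₁
Sat D σ ρ (x ≐ y)  = Lift _ (σ x ≡ σ y)
Sat D σ ρ (x ≤′ y) = Lift _ (σ x ≤ σ y)
Sat D σ ρ (S′ x y) = Lift _ (suc (σ x) ≡ σ y)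
Sat D σ ρ (Zero x) = Lift _ (σ x ≡ zero)
Sat D σ ρ (x ∈′ X) = Lift _ (ρ X (σ x))
Sat D σ ρ ⊤′ = Lift _ ⊤
Sat D σ ρ ⊥′ = Lift _ ⊥
Sat D σ ρ (φ ∧′ ψ) = Sat D σ ρ φ × Sat D σ ρ ψ
Sat D σ ρ (¬′ φ) = ¬ Sat D σ ρ φ
Sat D σ ρ (∃ᵢ x φ) = Σ ℕ (λ a → Lift (lsuc 0ℓ) (D a) × Sat D (σ [ x ↦ a ]) ρ φ)
Sat D σ ρ (∃ₚ X φ) = Σ (Pred ℕ 0ℓ) (λ P → Sat D σ (ρ [ X ↦ P ]) φ)

-- 𝔑 ⊨ φ  (unrelativized)
everything : Pred ℕ 0ℓ
everything _ = ⊤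

-- By induction on the formula, simultaneously for all decidable V and all cut points n.
-- An atom whose variables lie on one side of the cut goes to that side; an atom straddling
-- the cut has a constant truth value, except S(x, y), which holds exactly when x is the
-- greatest element of [0, n] and y the least element of (n, ∞).  Conjunction multiplies the
-- two disjunctions out, negation is De Morgan (the one use of excluded middle), a predicate
-- quantifier distributes over both sides because a witness can be glued from its restrictions
-- to the two sides, and ∃x is split according to whether x is assigned a value below or above
-- the cut, decomposing the body with x added to or removed from V.

module Submission where

open import Defs
import Level
open import Level using (0ℓ; lift) renaming (suc to lsuc)
open import Data.Nat using (ℕ; suc; _≤_; _<_; _≡ᵇ_; _≟_; _≤?_; s≤s)
open import Data.Nat.Properties
  using (≡⇒≡ᵇ; ≡ᵇ⇒≡; ≤-refl; ≤-trans; ≤-antisym; ≤-pred; <⇒≤; <⇒≱; ≰⇒>; ≤-<-trans; <-irrefl; 1+n≢n; n≤1+n)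
open import Data.Bool using (true; false)
open import Data.Fin using (Fin)
open import Data.List using (List; []; _∷_; _++_; map; length; lookup; cartesianProductWith)
open import Data.List.Membership.Propositional using (_∈_; _∉_; lose)
open import Data.List.Membership.Propositional.Properties using (∈-++⁺ˡ; ∈-++⁺ʳ; ∈-++⁻; ∈-filter⁺; ∈-filter⁻; ∈-lookup)
open import Data.List.Relation.Unary.Any as Any using (Any; here; there)
open import Data.List.Relation.Unary.Any.Properties
  using (map⁺; map⁻; ++↔; pure↔; Any-Σ⁺ʳ; Any-Σ⁻ʳ; lookup-index; cartesianProductWith⁺; cartesianProductWith⁻)
open import Data.List.Relation.Unary.All as All using (All; []; _∷_)
import Data.List.Relation.Unary.All.Properties as All
open import Data.Product using (Σ; ∃-syntax; _×_; _,_; proj₁; proj₂; map₁; map₂; uncurry)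
open import Data.Product.Function.NonDependent.Propositional using (_×-⇔_)
import Data.Product.Function.Dependent.Propositional as Σ
open import Data.Sum using (_⊎_; inj₁; inj₂; [_,_])
open import Data.Sum.Function.Propositional using (_⊎-⇔_)
open import Data.Unit using (tt)
open import Data.Empty using (⊥-elim)
open import Function using (_∘_; id)
open import Function.Bundles using (_⇔_; mk⇔; Equivalence)
open import Function.Construct.Identity using (⇔-id)
open import Function.Properties.Equivalence using () renaming (sym to ⇔-sym; trans to ⇔-trans)
open import Function.Related.TypeIsomorphisms using (¬-cong-⇔)
open import Function.Related.Propositional using (module EquationalReasoning)
open import Relation.Nullary using (¬_; ¬?; yes; no)
open import Relation.Nullary.Decidable using (decidable-stable)
open import Relation.Unary using (Pred; Decidable; _⊆_; _∩_; _∪_; ∁)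
open import Relation.Unary.Properties using (_∪?_; _∩?_; ∁?)
open import Relation.Binary.PropositionalEquality
  using (_≡_; _≢_; refl; sym; trans; subst; cong; cong₂; subst₂; setoid)
open import Axiom.ExcludedMiddle using (ExcludedMiddle)

private
  variable
    D : Pred ℕ 0ℓ
    V W : Pred ℕ 0ℓ
    n x a : ℕ
    σ σ′ : ℕ → ℕ
    ρ ρ′ : ℕ → Pred ℕ 0ℓ

-- Assignments, free variables and coincidence

[↦]-same : ∀ {ℓ} {A : Set ℓ} (f : ℕ → A) x v → (f [ x ↦ v ]) x ≡ v
[↦]-same f x v with x ≡ᵇ x | ≡⇒≡ᵇ x x refl
... | true  | _ = refl
... | false | ()

[↦]-other : ∀ {ℓ} {A : Set ℓ} (f : ℕ → A) x v {y} → y ≢ x → (f [ x ↦ v ]) y ≡ f y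
[↦]-other f x v {y} y≢x with y ≡ᵇ x | ≡ᵇ⇒≡ y x
... | false | _ = refl
... | true  | y≡x = ⊥-elim (y≢x (y≡x tt))

fv : Formula → Pred ℕ 0ℓ
fv φ y = y ∈ FVi φ

fv-∃ᵢ⁺ : ∀ φ {y} → y ∈ FVi φ → y ≢ x → y ∈ FVi (∃ᵢ x φ)
fv-∃ᵢ⁺ {x} φ = ∈-filter⁺ (λ y → ¬? (y ≟ x))

fv-∃ᵢ⁻ : ∀ φ {y} → y ∈ FVi (∃ᵢ x φ) → y ∈ FVi φ × y ≢ x
fv-∃ᵢ⁻ {x} φ = ∈-filter⁻ (λ y → ¬? (y ≟ x)) {xs = FVi φ}

fv-∧ : ∀ {P : Pred ℕ 0ℓ} φ ψ → fv φ ⊆ P → fv ψ ⊆ P → fv (φ ∧′ ψ) ⊆ P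
fv-∧ φ ψ φ⊆P ψ⊆P m = [ φ⊆P , ψ⊆P ] (∈-++⁻ (FVi φ) m)

coincidenceᵢ : ∀ φ → (∀ {y} → y ∈ FVi φ → σ y ≡ σ′ y) → Sat D σ ρ φ → Sat D σ′ ρ φ
coincidenceᵢ (p ≐ q) eq (lift e) = lift (subst₂ _≡_ (eq (here refl)) (eq (there (here refl))) e)
coincidenceᵢ (p ≤′ q) eq (lift e) = lift (subst₂ _≤_ (eq (here refl)) (eq (there (here refl))) e)
coincidenceᵢ (S′ p q) eq (lift e) = lift (subst₂ (λ b c → suc b ≡ c) (eq (here refl)) (eq (there (here refl))) e)
coincidenceᵢ (Zero p) eq (lift e) = lift (subst (_≡ 0) (eq (here refl)) e)
coincidenceᵢ {ρ = ρ} (p ∈′ X) eq (lift e) = lift (subst (ρ X) (eq (here refl)) e)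
coincidenceᵢ ⊤′ eq s = s
coincidenceᵢ ⊥′ eq s = s
coincidenceᵢ (φ ∧′ ψ) eq (s , t) =
  coincidenceᵢ φ (eq ∘ ∈-++⁺ˡ) s , coincidenceᵢ ψ (eq ∘ ∈-++⁺ʳ (FVi φ)) t
coincidenceᵢ (¬′ φ) eq ns s = ns (coincidenceᵢ φ (sym ∘ eq) s)
coincidenceᵢ {σ = σ} {σ′} (∃ᵢ x φ) eq (a , d , s) = a , d , coincidenceᵢ φ agree s
  where
  agree : ∀ {y} → y ∈ FVi φ → (σ [ x ↦ a ]) y ≡ (σ′ [ x ↦ a ]) y
  agree {y} m with y ≟ x
  ... | yes refl = trans ([↦]-same σ x a) (sym ([↦]-same σ′ x a))
  ... | no y≢x = trans ([↦]-other σ x a y≢x) (trans (eq (fv-∃ᵢ⁺ φ m y≢x)) (sym ([↦]-other σ′ x a y≢x)))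
coincidenceᵢ (∃ₚ X φ) eq (P , s) = P , coincidenceᵢ φ eq s

Sat-fresh : ∀ φ → x ∉ FVi φ → Sat D (σ [ x ↦ a ]) ρ φ ⇔ Sat D σ ρ φ
Sat-fresh {x} {σ = σ} {a} φ x∉φ = mk⇔ (coincidenceᵢ φ (λ m → [↦]-other σ x a (fresh m)))
                                       (coincidenceᵢ φ (λ m → sym ([↦]-other σ x a (fresh m))))
  where
  fresh : ∀ {y} → y ∈ FVi φ → y ≢ x
  fresh m refl = x∉φ m

AgreeOn : Pred ℕ 0ℓ → (ℕ → Pred ℕ 0ℓ) → (ℕ → Pred ℕ 0ℓ) → Set
AgreeOn D ρ ρ′ = ∀ X {a} → D a → ρ X a ⇔ ρ′ X a

AgreeOn-[↦] : ∀ {X P P′} → AgreeOn D ρ ρ′ → (∀ {a} → D a → P a ⇔ P′ a) →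
              AgreeOn D (ρ [ X ↦ P ]) (ρ′ [ X ↦ P′ ])
AgreeOn-[↦] {X = X} agree P⇔P′ Y d with Y ≡ᵇ X
... | true  = P⇔P′ d
... | false = agree Y d

coincidenceₚ : ∀ φ → fv φ ⊆ (D ∘ σ) → AgreeOn D ρ ρ′ → Sat D σ ρ φ → Sat D σ ρ′ φ
coincidenceₚ (p ≐ q) inD agree s = s
coincidenceₚ (p ≤′ q) inD agree s = s
coincidenceₚ (S′ p q) inD agree s = s
coincidenceₚ (Zero p) inD agree s = s
coincidenceₚ (p ∈′ X) inD agree (lift e) = lift (Equivalence.to (agree X (inD (here refl))) e)
coincidenceₚ ⊤′ inD agree s = s
coincidenceₚ ⊥′ inD agree s = s
coincidenceₚ (φ ∧′ ψ) inD agree (s , t) =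
  coincidenceₚ φ (inD ∘ ∈-++⁺ˡ) agree s , coincidenceₚ ψ (inD ∘ ∈-++⁺ʳ (FVi φ)) agree t
coincidenceₚ (¬′ φ) inD agree ns s = ns (coincidenceₚ φ inD (λ X d → ⇔-sym (agree X d)) s)
coincidenceₚ {D} {σ} (∃ᵢ x φ) inD agree (a , lift d , s) = a , lift d , coincidenceₚ φ inD′ agree s
  where
  inD′ : fv φ ⊆ (D ∘ (σ [ x ↦ a ]))
  inD′ {y} m with y ≟ x
  ... | yes refl = subst D (sym ([↦]-same σ x a)) d
  ... | no y≢x = subst D (sym ([↦]-other σ x a y≢x)) (inD (fv-∃ᵢ⁺ φ m y≢x))
coincidenceₚ (∃ₚ X φ) inD agree (P , s) = P , coincidenceₚ φ inD (AgreeOn-[↦] agree (λ _ → ⇔-id _)) s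

-- The greatest and least elements of the domain

x≢1+x : ∀ x → x ≢ suc x
x≢1+x x = 1+n≢n ∘ sym

-- The bound variable suc x is merely some name different from x.
isGreatest isLeast : ℕ → Formula
isGreatest x = ¬′ ∃ᵢ (suc x) (¬′ (suc x ≤′ x))
isLeast x = ¬′ ∃ᵢ (suc x) (¬′ (x ≤′ suc x))

fv-isGreatest : ∀ {x} {P : Pred ℕ 0ℓ} → P x → fv (isGreatest x) ⊆ P
fv-isGreatest {x} px m with fv-∃ᵢ⁻ {suc x} (¬′ (suc x ≤′ x)) m
... | here refl , y≢1+x = ⊥-elim (y≢1+x refl)
... | there (here refl) , _ = px

fv-isLeast : ∀ {x} {P : Pred ℕ 0ℓ} → P x → fv (isLeast x) ⊆ P
fv-isLeast {x} px m with fv-∃ᵢ⁻ {suc x} (¬′ (x ≤′ suc x)) m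
... | here refl , _ = px
... | there (here refl) , y≢1+x = ⊥-elim (y≢1+x refl)

Sat-isGreatest : Sat D σ ρ (isGreatest x) ⇔ (∀ a → D a → a ≤ σ x)
Sat-isGreatest {D} {σ} {x = x} = mk⇔
  (λ ¬counterexample a d → decidable-stable (a ≤? σ x)
                             (λ a≰σx → ¬counterexample (a , lift d , a≰σx ∘ subst id (inner a) ∘ Level.lower)))
  (λ greatest (a , lift d , a≰σx) → a≰σx (lift (subst id (sym (inner a)) (greatest a d))))
  where
  inner : ∀ a → ((σ [ suc x ↦ a ]) (suc x) ≤ (σ [ suc x ↦ a ]) x) ≡ (a ≤ σ x)
  inner a = cong₂ _≤_ ([↦]-same σ (suc x) a) ([↦]-other σ (suc x) a (x≢1+x x))

Sat-isLeast : Sat D σ ρ (isLeast x) ⇔ (∀ a → D a → σ x ≤ a)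
Sat-isLeast {D} {σ} {x = x} = mk⇔
  (λ ¬counterexample a d → decidable-stable (σ x ≤? a)
                             (λ σx≰a → ¬counterexample (a , lift d , σx≰a ∘ subst id (inner a) ∘ Level.lower)))
  (λ least (a , lift d , σx≰a) → σx≰a (lift (subst id (sym (inner a)) (least a d))))
  where
  inner : ∀ a → ((σ [ suc x ↦ a ]) x ≤ (σ [ suc x ↦ a ]) (suc x)) ≡ (σ x ≤ a)
  inner a = cong₂ _≤_ ([↦]-other σ (suc x) a (x≢1+x x)) ([↦]-same σ (suc x) a)

-- Disjunctions of separated pairs

SatBelow SatAbove : ℕ → (ℕ → ℕ) → (ℕ → Pred ℕ 0ℓ) → Formula → Set₁
SatBelow n = Sat (_≤ n)
SatAbove n = Sat (n <_)

SatPair : ℕ → (ℕ → ℕ) → (ℕ → Pred ℕ 0ℓ) → Formula × Formula → Set₁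
SatPair n σ ρ (l , r) = SatBelow n σ ρ l × SatAbove n σ ρ r

record Separated (P Q : Pred ℕ 0ℓ) (p : Formula × Formula) : Set where
  constructor _,_
  field
    left  : fv (proj₁ p) ⊆ P
    right : fv (proj₂ p) ⊆ Q

Separated-mono : ∀ {P P′ Q Q′ : Pred ℕ 0ℓ} → P ⊆ P′ → Q ⊆ Q′ → Separated P Q ⊆ Separated P′ Q′
Separated-mono P⊆P′ Q⊆Q′ (l⊆P , r⊆Q) = P⊆P′ ∘ l⊆P , Q⊆Q′ ∘ r⊆Q

record Splits (V : Pred ℕ 0ℓ) (n : ℕ) (σ : ℕ → ℕ) (y : ℕ) : Set where
  constructor _,_
  field
    below : V y → σ y ≤ n
    above : ¬ V y → n < σ y

Separated-placed : ∀ φ → fv φ ⊆ Splits V n σ →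
  Separated (fv φ ∩ V) (fv φ ∩ ∁ V) ⊆ Separated ((_≤ n) ∘ σ) ((n <_) ∘ σ)
Separated-placed φ splits = Separated-mono (λ (m , v) → Splits.below (splits m) v) (λ (m , ¬v) → Splits.above (splits m) ¬v)

module _ {ℓ q p r} {A : Set ℓ} {Q : Pred A q} {P : Pred A p} {R : Pred A r} where

  Any-cong-All : ∀ {xs} → All Q xs → (∀ {x} → Q x → P x ⇔ R x) → Any P xs ⇔ Any R xs
  Any-cong-All qs P⇔R = mk⇔ (transport (Equivalence.to ∘ P⇔R) qs) (transport (Equivalence.from ∘ P⇔R) qs)
    where
    transport : ∀ {s t} {S : Pred A s} {T : Pred A t} {xs} → (∀ {x} → Q x → S x → T x) → All Q xs → Any S xs → Any T xs
    transport f (q ∷ _) (here s) = here (f q s)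
    transport f (_ ∷ qs) (there s) = there (transport f qs s)

Any-∃-bounded : ∀ {ℓ} {A : Set ℓ} {B : Set} {R : Pred B 0ℓ} {P : B → Pred A (lsuc 0ℓ)} {xs} →
                Any (λ p → ∃[ b ] (R b × P b p)) xs ⇔ (∃[ b ] (R b × Any (P b) xs))
Any-∃-bounded = mk⇔
  (λ h → let b , h′ = Any-Σ⁻ʳ h in b , proj₁ (proj₂ (Any.satisfied h′)) , Any.map proj₂ h′)
  (λ (b , rb , h) → Any-Σ⁺ʳ (b , Any.map (rb ,_) h))

Any⇔∃-lookup : ∀ {ℓ p} {A : Set ℓ} {P : Pred A p} xs → Any P xs ⇔ (∃[ j ] P (lookup xs j))
Any⇔∃-lookup xs = mk⇔ (λ h → Any.index h , lookup-index h) (λ (j , pj) → lose (∈-lookup j) pj)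

_∧ᵖ_ : Formula × Formula → Formula × Formula → Formula × Formula
(l , r) ∧ᵖ (l′ , r′) = l ∧′ l′ , r ∧′ r′

conjoin : List (Formula × Formula) → List (Formula × Formula) → List (Formula × Formula)
conjoin = cartesianProductWith _∧ᵖ_

Any-conjoin : ∀ ps qs → Any (SatPair n σ ρ) (conjoin ps qs) ⇔ (Any (SatPair n σ ρ) ps × Any (SatPair n σ ρ) qs)
Any-conjoin ps qs = mk⇔
  (cartesianProductWith⁻ _∧ᵖ_ (λ ((sl , sl′) , (sr , sr′)) → (sl , sr) , (sl′ , sr′)) ps qs)
  (uncurry (cartesianProductWith⁺ _∧ᵖ_ (λ (sl , sr) (sl′ , sr′) → (sl , sl′) , (sr , sr′))))

Separated-∧ᵖ : ∀ {P Q} p q → Separated P Q p → Separated P Q q → Separated P Q (p ∧ᵖ q)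
Separated-∧ᵖ (l , r) (l′ , r′) (l⊆ , r⊆) (l′⊆ , r′⊆) = fv-∧ l l′ l⊆ l′⊆ , fv-∧ r r′ r⊆ r′⊆

separated-conjoin : ∀ {P Q} ps qs → All (Separated P Q) ps → All (Separated P Q) qs →
                    All (Separated P Q) (conjoin ps qs)
separated-conjoin ps qs sps sqs = All.cartesianProductWith⁺ (setoid _) (setoid _) _∧ᵖ_ ps qs
  (λ {p} {q} p∈ q∈ → Separated-∧ᵖ p q (All.lookup sps p∈) (All.lookup sqs q∈))

negatePair : Formula × Formula → List (Formula × Formula)
negatePair (l , r) = (¬′ l , ⊤′) ∷ (⊤′ , ¬′ r) ∷ []

-- De Morgan: ¬ ⋁ⱼ (lⱼ ∧ rⱼ) is ⋀ⱼ (¬ lⱼ ∨ ¬ rⱼ), multiplied out by conjoin.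
negate : List (Formula × Formula) → List (Formula × Formula)
negate [] = (⊤′ , ⊤′) ∷ []
negate (p ∷ ps) = conjoin (negatePair p) (negate ps)

Any-negatePair : ExcludedMiddle (lsuc 0ℓ) → ∀ p → Any (SatPair n σ ρ) (negatePair p) ⇔ (¬ SatPair n σ ρ p)
Any-negatePair {n} {σ} {ρ} em (l , r) = mk⇔
  (λ { (here (¬sl , _)) (sl , _) → ¬sl sl ; (there (here (_ , ¬sr))) (_ , sr) → ¬sr sr })
  deMorgan
  where
  deMorgan : ¬ SatPair n σ ρ (l , r) → Any (SatPair n σ ρ) (negatePair (l , r))
  deMorgan ¬s with em {SatBelow n σ ρ l}
  ... | yes sl = there (here (lift tt , λ sr → ¬s (sl , sr)))
  ... | no ¬sl = here (¬sl , lift tt)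

Any-negate : ExcludedMiddle (lsuc 0ℓ) → ∀ ps → Any (SatPair n σ ρ) (negate ps) ⇔ (¬ Any (SatPair n σ ρ) ps)
Any-negate em [] = mk⇔ (λ _ ()) (λ _ → here (lift tt , lift tt))
Any-negate {n} {σ} {ρ} em (p ∷ ps) = begin
  Any S (conjoin (negatePair p) (negate ps)) ∼⟨ Any-conjoin (negatePair p) (negate ps) ⟩
  (Any S (negatePair p) × Any S (negate ps)) ∼⟨ Any-negatePair em p ×-⇔ Any-negate em ps ⟩
  (¬ S p × ¬ Any S ps)                       ∼⟨ ¬Any-∷ ⟩
  (¬ Any S (p ∷ ps))                         ∎
  where
  open EquationalReasoning
  S = SatPair n σ ρ
  ¬Any-∷ : (¬ S p × ¬ Any S ps) ⇔ (¬ Any S (p ∷ ps))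
  ¬Any-∷ = mk⇔ (λ (¬s , ¬ss) → λ { (here s) → ¬s s ; (there s) → ¬ss s }) (λ ¬h → ¬h ∘ here , ¬h ∘ there)

separated-negate : ∀ {P Q} ps → All (Separated P Q) ps → All (Separated P Q) (negate ps)
separated-negate [] [] = ((λ ()) , (λ ())) ∷ []
separated-negate (_ ∷ ps) ((l⊆ , r⊆) ∷ sps) =
  separated-conjoin _ (negate ps) ((l⊆ , λ ()) ∷ ((λ ()) , r⊆) ∷ []) (separated-negate ps sps)

glue : ℕ → Pred ℕ 0ℓ → Pred ℕ 0ℓ → Pred ℕ 0ℓ
glue n P Q a = (a ≤ n × P a) ⊎ (n < a × Q a)

glue-below : ∀ {P Q} → a ≤ n → P a ⇔ glue n P Q a
glue-below a≤n = mk⇔ (λ p → inj₁ (a≤n , p)) [ proj₂ , (λ (n<a , _) → ⊥-elim (<⇒≱ n<a a≤n)) ]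

glue-above : ∀ {P Q} → n < a → Q a ⇔ glue n P Q a
glue-above n<a = mk⇔ (λ q → inj₂ (n<a , q)) [ (λ (a≤n , _) → ⊥-elim (<⇒≱ n<a a≤n)) , proj₂ ]

∃ₚ-both : ℕ → Formula × Formula → Formula × Formula
∃ₚ-both X (l , r) = ∃ₚ X l , ∃ₚ X r

SatPair-∃ₚ : ∀ {X} p → Separated ((_≤ n) ∘ σ) ((n <_) ∘ σ) p →
             SatPair n σ ρ (∃ₚ-both X p) ⇔ (∃[ P ] SatPair n σ (ρ [ X ↦ P ]) p)
SatPair-∃ₚ {n} (l , r) (l≤n , n<r) = mk⇔
  (λ ((P , sl) , (Q , sr)) → glue n P Q ,
     coincidenceₚ l l≤n (AgreeOn-[↦] (λ _ _ → ⇔-id _) (glue-below {P = P} {Q})) sl ,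
     coincidenceₚ r n<r (AgreeOn-[↦] (λ _ _ → ⇔-id _) (glue-above {P = P} {Q})) sr)
  (λ (P , sl , sr) → (P , sl) , (P , sr))

Any-∃ₚ : ∀ X ps → All (Separated ((_≤ n) ∘ σ) ((n <_) ∘ σ)) ps →
         Any (SatPair n σ ρ) (map (∃ₚ-both X) ps) ⇔ (∃[ P ] Any (SatPair n σ (ρ [ X ↦ P ])) ps)
Any-∃ₚ {n} {σ} {ρ} X ps placed = begin
  Any (SatPair n σ ρ) (map (∃ₚ-both X) ps)               ∼⟨ mk⇔ map⁻ map⁺ ⟩
  Any (SatPair n σ ρ ∘ ∃ₚ-both X) ps                     ∼⟨ Any-cong-All placed (SatPair-∃ₚ _) ⟩
  Any (λ p → ∃[ P ] SatPair n σ (ρ [ X ↦ P ]) p) ps      ∼⟨ mk⇔ Any-Σ⁻ʳ Any-Σ⁺ʳ ⟩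
  (∃[ P ] Any (SatPair n σ (ρ [ X ↦ P ])) ps)            ∎
  where open EquationalReasoning

SatPair-∃ᵢˡ : ∀ p → x ∉ FVi (proj₂ p) →
              SatPair n σ ρ (map₁ (∃ᵢ x) p) ⇔ (∃[ a ] (a ≤ n × SatPair n (σ [ x ↦ a ]) ρ p))
SatPair-∃ᵢˡ (l , r) x∉r = mk⇔
  (λ ((a , lift a≤n , sl) , sr) → a , a≤n , sl , Equivalence.from (Sat-fresh r x∉r) sr)
  (λ (a , a≤n , sl , sr) → (a , lift a≤n , sl) , Equivalence.to (Sat-fresh r x∉r) sr)

SatPair-∃ᵢʳ : ∀ p → x ∉ FVi (proj₁ p) →
              SatPair n σ ρ (map₂ (∃ᵢ x) p) ⇔ (∃[ a ] (n < a × SatPair n (σ [ x ↦ a ]) ρ p))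
SatPair-∃ᵢʳ (l , r) x∉l = mk⇔
  (λ (sl , (a , lift n<a , sr)) → a , n<a , Equivalence.from (Sat-fresh l x∉l) sl , sr)
  (λ (a , n<a , sl , sr) → Equivalence.to (Sat-fresh l x∉l) sl , (a , lift n<a , sr))

Any-∃ᵢˡ : ∀ ps → All ((x ∉_) ∘ FVi ∘ proj₂) ps →
          Any (SatPair n σ ρ) (map (map₁ (∃ᵢ x)) ps) ⇔ (∃[ a ] (a ≤ n × Any (SatPair n (σ [ x ↦ a ]) ρ) ps))
Any-∃ᵢˡ {x} {n} {σ} {ρ} ps fresh = begin
  Any (SatPair n σ ρ) (map (map₁ (∃ᵢ x)) ps)                       ∼⟨ mk⇔ map⁻ map⁺ ⟩
  Any (SatPair n σ ρ ∘ map₁ (∃ᵢ x)) ps                             ∼⟨ Any-cong-All fresh (SatPair-∃ᵢˡ _) ⟩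
  Any (λ p → ∃[ a ] (a ≤ n × SatPair n (σ [ x ↦ a ]) ρ p)) ps      ∼⟨ Any-∃-bounded ⟩
  (∃[ a ] (a ≤ n × Any (SatPair n (σ [ x ↦ a ]) ρ) ps))            ∎
  where open EquationalReasoning

Any-∃ᵢʳ : ∀ ps → All ((x ∉_) ∘ FVi ∘ proj₁) ps →
          Any (SatPair n σ ρ) (map (map₂ (∃ᵢ x)) ps) ⇔ (∃[ a ] (n < a × Any (SatPair n (σ [ x ↦ a ]) ρ) ps))
Any-∃ᵢʳ {x} {n} {σ} {ρ} ps fresh = begin
  Any (SatPair n σ ρ) (map (map₂ (∃ᵢ x)) ps)                       ∼⟨ mk⇔ map⁻ map⁺ ⟩
  Any (SatPair n σ ρ ∘ map₂ (∃ᵢ x)) ps                             ∼⟨ Any-cong-All fresh (SatPair-∃ᵢʳ _) ⟩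
  Any (λ p → ∃[ a ] (n < a × SatPair n (σ [ x ↦ a ]) ρ p)) ps      ∼⟨ Any-∃-bounded ⟩
  (∃[ a ] (n < a × Any (SatPair n (σ [ x ↦ a ]) ρ) ps))            ∎
  where open EquationalReasoning

-- Decompositions

record Decomposition (V : Pred ℕ 0ℓ) (φ : Formula) : Set₂ where
  field
    pairs     : List (Formula × Formula)
    separated : All (Separated (fv φ ∩ V) (fv φ ∩ ∁ V)) pairs
    correct   : ExcludedMiddle (lsuc 0ℓ) → ∀ n σ ρ → fv φ ⊆ Splits V n σ →
                Sat everything σ ρ φ ⇔ Any (SatPair n σ ρ) pairs

Separated-weaken : ∀ φ ψ → fv φ ⊆ fv ψ →
  Separated (fv φ ∩ V) (fv φ ∩ ∁ V) ⊆ Separated (fv ψ ∩ V) (fv ψ ∩ ∁ V)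
Separated-weaken φ ψ φ⊆ψ = Separated-mono (map₁ φ⊆ψ) (map₁ φ⊆ψ)

DomainIndependent : Formula → Set₁
DomainIndependent φ = ∀ {D D′ σ ρ} → Sat D σ ρ φ → Sat D′ σ ρ φ

lower-decomposition : ∀ {φ} → DomainIndependent φ → fv φ ⊆ V → Decomposition V φ
lower-decomposition {φ = φ} independent φ⊆V = record
  { pairs     = (φ , ⊤′) ∷ []
  ; separated = ((λ m → m , φ⊆V m) , λ ()) ∷ []
  ; correct   = λ _ _ _ _ _ → mk⇔ (λ s → here (independent s , lift tt))
                                  (λ { (here (s , _)) → independent s ; (there ()) }) }

upper-decomposition : ∀ {φ} → DomainIndependent φ → fv φ ⊆ ∁ V → Decomposition V φ
upper-decomposition {φ = φ} independent φ⊆∁V = record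
  { pairs     = (⊤′ , φ) ∷ []
  ; separated = ((λ ()) , λ m → m , φ⊆∁V m) ∷ []
  ; correct   = λ _ _ _ _ _ → mk⇔ (λ s → here (lift tt , independent s))
                                  (λ { (here (_ , s)) → independent s ; (there ()) }) }

unsatisfiable-decomposition : ∀ {φ} → (∀ n σ ρ → fv φ ⊆ Splits V n σ → ¬ Sat everything σ ρ φ) →
                             Decomposition V φ
unsatisfiable-decomposition unsat = record
  { pairs     = []
  ; separated = []
  ; correct   = λ _ n σ ρ splits → mk⇔ (⊥-elim ∘ unsat n σ ρ splits) (λ ()) }

valid-decomposition : ∀ {φ} → (∀ n σ ρ → fv φ ⊆ Splits V n σ → Sat everything σ ρ φ) → Decomposition V φ
valid-decomposition valid = record
  { pairs     = (⊤′ , ⊤′) ∷ []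
  ; separated = ((λ ()) , (λ ())) ∷ []
  ; correct   = λ _ n σ ρ splits → mk⇔ (λ _ → here (lift tt , lift tt)) (λ _ → valid n σ ρ splits) }

straddle : ∀ {p q} → Splits V n σ p → V p → Splits V n σ q → ¬ V q → σ p < σ q
straddle (p≤n , _) vp (_ , n<q) ¬vq = ≤-<-trans (p≤n vp) (n<q ¬vq)

succ-straddle : ∀ {m k} → m ≤ n → n < k → (suc m ≡ k) ⇔ ((∀ a → a ≤ n → a ≤ m) × (∀ a → n < a → k ≤ a))
succ-straddle {n} {m} {k} m≤n n<k = mk⇔
  (λ { refl → (λ a a≤n → ≤-trans a≤n (≤-pred n<k)) , (λ a n<a → ≤-trans (s≤s m≤n) n<a) })
  (λ (greatest , least) → trans (cong suc (≤-antisym m≤n (greatest n ≤-refl)))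
                                (≤-antisym n<k (least (suc n) ≤-refl)))

succ-decomposition : ∀ {p q} → V p → ¬ V q → Decomposition V (S′ p q)
succ-decomposition {V} {p} {q} vp ¬vq = record
  { pairs     = (isGreatest p , isLeast q) ∷ []
  ; separated = (fv-isGreatest {P = fv (S′ p q) ∩ V} (here refl , vp) ,
                  fv-isLeast {P = fv (S′ p q) ∩ ∁ V} (there (here refl) , ¬vq)) ∷ []
  ; correct   = correct }
  where
  correct : ExcludedMiddle (lsuc 0ℓ) → ∀ n σ ρ → fv (S′ p q) ⊆ Splits V n σ →
            Sat everything σ ρ (S′ p q) ⇔ Any (SatPair n σ ρ) ((isGreatest p , isLeast q) ∷ [])
  correct _ n σ ρ splits = begin
    Sat everything σ ρ (S′ p q)                            ∼⟨ mk⇔ Level.lower lift ⟩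
    suc (σ p) ≡ σ q                                        ∼⟨ succ-straddle σp≤n n<σq ⟩
    ((∀ a → a ≤ n → a ≤ σ p) × (∀ a → n < a → σ q ≤ a))
      ∼⟨ ⇔-sym (Sat-isGreatest {σ = σ} {ρ = ρ} {x = p} ×-⇔ Sat-isLeast {σ = σ} {ρ = ρ} {x = q}) ⟩
    SatPair n σ ρ (isGreatest p , isLeast q)               ↔⟨ pure↔ ⟩
    Any (SatPair n σ ρ) ((isGreatest p , isLeast q) ∷ [])  ∎
    where
    open EquationalReasoning
    σp≤n = Splits.below (splits (here refl)) vp
    n<σq = Splits.above (splits (there (here refl))) ¬vq

∧-decomposition : ∀ {φ ψ} → Decomposition V φ → Decomposition V ψ → Decomposition V (φ ∧′ ψ)
∧-decomposition {φ = φ} {ψ} A B = record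
  { pairs     = conjoin A.pairs B.pairs
  ; separated = separated-conjoin A.pairs B.pairs
                  (All.map (Separated-weaken φ (φ ∧′ ψ) ∈-++⁺ˡ) A.separated)
                  (All.map (Separated-weaken ψ (φ ∧′ ψ) (∈-++⁺ʳ (FVi φ))) B.separated)
  ; correct   = λ em n σ ρ splits →
      ⇔-trans (A.correct em n σ ρ (splits ∘ ∈-++⁺ˡ) ×-⇔ B.correct em n σ ρ (splits ∘ ∈-++⁺ʳ (FVi φ)))
              (⇔-sym (Any-conjoin A.pairs B.pairs)) }
  where
  module A = Decomposition A
  module B = Decomposition B

¬-decomposition : ∀ {φ} → Decomposition V φ → Decomposition V (¬′ φ)
¬-decomposition A = record
  { pairs     = negate A.pairs
  ; separated = separated-negate A.pairs A.separated
  ; correct   = λ em n σ ρ splits →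
      ⇔-trans (¬-cong-⇔ (A.correct em n σ ρ splits)) (⇔-sym (Any-negate em A.pairs)) }
  where
  module A = Decomposition A

∃ₚ-decomposition : ∀ X {φ} → Decomposition V φ → Decomposition V (∃ₚ X φ)
∃ₚ-decomposition X {φ} A = record
  { pairs     = map (∃ₚ-both X) A.pairs
  ; separated = All.map⁺ (All.map (λ (l⊆ , r⊆) → l⊆ , r⊆) A.separated)
  ; correct   = λ em n σ ρ splits →
      ⇔-trans (Σ.congˡ (A.correct em n σ _ splits))
              (⇔-sym (Any-∃ₚ X A.pairs (All.map (Separated-placed φ splits) A.separated))) }
  where
  module A = Decomposition A

Sat-∃ᵢ-split : ∀ φ n → Sat everything σ ρ (∃ᵢ x φ) ⇔
  ((∃[ a ] (a ≤ n × Sat everything (σ [ x ↦ a ]) ρ φ)) ⊎ (∃[ a ] (n < a × Sat everything (σ [ x ↦ a ]) ρ φ)))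
Sat-∃ᵢ-split {σ} {ρ} {x} φ n = mk⇔ split [ unsplit , unsplit ]
  where
  split : Sat everything σ ρ (∃ᵢ x φ) → _
  split (a , _ , s) with a ≤? n
  ... | yes a≤n = inj₁ (a , a≤n , s)
  ... | no a≰n = inj₂ (a , ≰⇒> a≰n , s)
  unsplit : ∀ {R : Pred ℕ 0ℓ} → ∃[ a ] (R a × Sat everything (σ [ x ↦ a ]) ρ φ) → Sat everything σ ρ (∃ᵢ x φ)
  unsplit (a , _ , s) = a , lift tt , s

Splits-[↦] : ∀ φ → (∀ {y} → y ≢ x → W y ⇔ V y) → Splits W n (σ [ x ↦ a ]) x →
             fv (∃ᵢ x φ) ⊆ Splits V n σ → fv φ ⊆ Splits W n (σ [ x ↦ a ])
Splits-[↦] {x} {n = n} {σ = σ} {a} φ W⇔V splits-x splits {y} m with y ≟ x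
... | yes refl = splits-x
... | no y≢x =
  (λ w → subst (_≤ n) σ′y≡σy (below (Equivalence.to (W⇔V y≢x) w))) ,
  (λ ¬w → subst (n <_) σ′y≡σy (above (¬w ∘ Equivalence.from (W⇔V y≢x))))
  where
  open Splits (splits (fv-∃ᵢ⁺ φ m y≢x))
  σ′y≡σy = sym ([↦]-other σ x a y≢x)

⊆-∃ᵢ-bound : ∀ {P Q : Pred ℕ 0ℓ} ψ φ → (∀ {y} → y ≢ x → P y → Q y) →
             fv ψ ⊆ fv φ ∩ P → fv (∃ᵢ x ψ) ⊆ fv (∃ᵢ x φ) ∩ Q
⊆-∃ᵢ-bound ψ φ P⇒Q ψ⊆ m =
  let m′ , y≢x = fv-∃ᵢ⁻ ψ m; mφ , py = ψ⊆ m′ in fv-∃ᵢ⁺ φ mφ y≢x , P⇒Q y≢x py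

⊆-∃ᵢ-free : ∀ {P Q : Pred ℕ 0ℓ} ψ φ → (∀ {y} → P y → y ≢ x × Q y) →
            fv ψ ⊆ fv φ ∩ P → fv ψ ⊆ fv (∃ᵢ x φ) ∩ Q
⊆-∃ᵢ-free ψ φ P⇒Q ψ⊆ m =
  let mφ , py = ψ⊆ m; y≢x , qy = P⇒Q py in fv-∃ᵢ⁺ φ mφ y≢x , qy

∃ᵢ-decomposition : ∀ x {φ} → Decomposition (V ∪ (_≡ x)) φ → Decomposition (V ∩ ∁ (_≡ x)) φ →
                   Decomposition V (∃ᵢ x φ)
∃ᵢ-decomposition {V} x {φ} A B = record
  { pairs     = map (map₁ (∃ᵢ x)) A.pairs ++ map (map₂ (∃ᵢ x)) B.pairs
  ; separated = All.++⁺ (All.map⁺ (All.map separatedᴬ A.separated))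
                        (All.map⁺ (All.map separatedᴮ B.separated))
  ; correct   = correct }
  where
  module A = Decomposition A
  module B = Decomposition B

  Vᴬ Vᴮ : Pred ℕ 0ℓ
  Vᴬ = V ∪ (_≡ x)
  Vᴮ = V ∩ ∁ (_≡ x)

  separatedᴬ : Separated (fv φ ∩ Vᴬ) (fv φ ∩ ∁ Vᴬ) ⊆
               (Separated (fv (∃ᵢ x φ) ∩ V) (fv (∃ᵢ x φ) ∩ ∁ V) ∘ map₁ (∃ᵢ x))
  separatedᴬ {l , r} (l⊆ , r⊆) =
    ⊆-∃ᵢ-bound l φ (λ y≢x → [ id , ⊥-elim ∘ y≢x ]) l⊆ , ⊆-∃ᵢ-free r φ (λ ¬w → ¬w ∘ inj₂ , ¬w ∘ inj₁) r⊆

  separatedᴮ : Separated (fv φ ∩ Vᴮ) (fv φ ∩ ∁ Vᴮ) ⊆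
               (Separated (fv (∃ᵢ x φ) ∩ V) (fv (∃ᵢ x φ) ∩ ∁ V) ∘ map₂ (∃ᵢ x))
  separatedᴮ {l , r} (l⊆ , r⊆) =
    ⊆-∃ᵢ-free l φ (λ (v , y≢x) → y≢x , v) l⊆ , ⊆-∃ᵢ-bound r φ (λ y≢x ¬w v → ¬w (v , y≢x)) r⊆

  freshᴬ : Separated (fv φ ∩ Vᴬ) (fv φ ∩ ∁ Vᴬ) ⊆ ((x ∉_) ∘ FVi ∘ proj₂)
  freshᴬ (_ , r⊆) x∈r = proj₂ (r⊆ x∈r) (inj₂ refl)

  freshᴮ : Separated (fv φ ∩ Vᴮ) (fv φ ∩ ∁ Vᴮ) ⊆ ((x ∉_) ∘ FVi ∘ proj₁)
  freshᴮ (l⊆ , _) x∈l = proj₂ (proj₂ (l⊆ x∈l)) refl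

  correct : ExcludedMiddle (lsuc 0ℓ) → ∀ n σ ρ → fv (∃ᵢ x φ) ⊆ Splits V n σ →
            Sat everything σ ρ (∃ᵢ x φ) ⇔
            Any (SatPair n σ ρ) (map (map₁ (∃ᵢ x)) A.pairs ++ map (map₂ (∃ᵢ x)) B.pairs)
  correct em n σ ρ splits = begin
    Sat everything σ ρ (∃ᵢ x φ)
      ∼⟨ Sat-∃ᵢ-split φ n ⟩
    ((∃[ a ] (a ≤ n × Sat everything (σ [ x ↦ a ]) ρ φ)) ⊎ (∃[ a ] (n < a × Sat everything (σ [ x ↦ a ]) ρ φ)))
      ∼⟨ Σ.congˡ (λ {a} → Σ.congˡ (λ {a≤n} → A.correct em n (σ [ x ↦ a ]) ρ (splitsᴬ a≤n))) ⊎-⇔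
         Σ.congˡ (λ {a} → Σ.congˡ (λ {n<a} → B.correct em n (σ [ x ↦ a ]) ρ (splitsᴮ n<a))) ⟩
    ((∃[ a ] (a ≤ n × Any (S a) A.pairs)) ⊎ (∃[ a ] (n < a × Any (S a) B.pairs)))
      ∼⟨ ⇔-sym (Any-∃ᵢˡ A.pairs (All.map freshᴬ A.separated) ⊎-⇔ Any-∃ᵢʳ B.pairs (All.map freshᴮ B.separated)) ⟩
    (Any (SatPair n σ ρ) (map (map₁ (∃ᵢ x)) A.pairs) ⊎ Any (SatPair n σ ρ) (map (map₂ (∃ᵢ x)) B.pairs))
      ↔⟨ ++↔ ⟩
    Any (SatPair n σ ρ) (map (map₁ (∃ᵢ x)) A.pairs ++ map (map₂ (∃ᵢ x)) B.pairs)
      ∎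
    where
    open EquationalReasoning
    S : ℕ → Formula × Formula → Set₁
    S a = SatPair n (σ [ x ↦ a ]) ρ
    splitsᴬ : ∀ {a} → a ≤ n → fv φ ⊆ Splits Vᴬ n (σ [ x ↦ a ])
    splitsᴬ {a} a≤n = Splits-[↦] φ (λ y≢x → mk⇔ [ id , ⊥-elim ∘ y≢x ] inj₁)
      ((λ _ → subst (_≤ n) (sym ([↦]-same σ x a)) a≤n) , (λ ¬w → ⊥-elim (¬w (inj₂ refl)))) splits
    splitsᴮ : ∀ {a} → n < a → fv φ ⊆ Splits Vᴮ n (σ [ x ↦ a ])
    splitsᴮ {a} n<a = Splits-[↦] φ (λ y≢x → mk⇔ proj₁ (_, y≢x))
      ((λ (_ , x≢x) → ⊥-elim (x≢x refl)) , (λ _ → subst (n <_) (sym ([↦]-same σ x a)) n<a)) splits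

decompose : Decidable V → ∀ φ → Decomposition V φ
decompose V? (p ≐ q) with V? p | V? q
... | yes vp | yes vq = lower-decomposition id (All.lookup (vp ∷ vq ∷ []))
... | no ¬vp | no ¬vq = upper-decomposition id (All.lookup (¬vp ∷ ¬vq ∷ []))
... | yes vp | no ¬vq = unsatisfiable-decomposition λ _ _ _ splits (lift e) →
  <-irrefl e (straddle (splits (here refl)) vp (splits (there (here refl))) ¬vq)
... | no ¬vp | yes vq = unsatisfiable-decomposition λ _ _ _ splits (lift e) →
  <-irrefl (sym e) (straddle (splits (there (here refl))) vq (splits (here refl)) ¬vp)
decompose V? (p ≤′ q) with V? p | V? q
... | yes vp | yes vq = lower-decomposition id (All.lookup (vp ∷ vq ∷ []))
... | no ¬vp | no ¬vq = upper-decomposition id (All.lookup (¬vp ∷ ¬vq ∷ []))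
... | yes vp | no ¬vq = valid-decomposition λ _ _ _ splits →
  lift (<⇒≤ (straddle (splits (here refl)) vp (splits (there (here refl))) ¬vq))
... | no ¬vp | yes vq = unsatisfiable-decomposition λ _ _ _ splits (lift e) →
  <⇒≱ (straddle (splits (there (here refl))) vq (splits (here refl)) ¬vp) e
decompose V? (S′ p q) with V? p | V? q
... | yes vp | yes vq = lower-decomposition id (All.lookup (vp ∷ vq ∷ []))
... | no ¬vp | no ¬vq = upper-decomposition id (All.lookup (¬vp ∷ ¬vq ∷ []))
... | yes vp | no ¬vq = succ-decomposition vp ¬vq
... | no ¬vp | yes vq = unsatisfiable-decomposition λ _ σ _ splits (lift e) →
  <⇒≱ (straddle (splits (there (here refl))) vq (splits (here refl)) ¬vp) (subst (σ p ≤_) e (n≤1+n (σ p)))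
decompose V? (Zero p) with V? p
... | yes vp = lower-decomposition id (All.lookup (vp ∷ []))
... | no ¬vp = upper-decomposition id (All.lookup (¬vp ∷ []))
decompose V? (p ∈′ X) with V? p
... | yes vp = lower-decomposition id (All.lookup (vp ∷ []))
... | no ¬vp = upper-decomposition id (All.lookup (¬vp ∷ []))
decompose V? ⊤′ = valid-decomposition λ _ _ _ _ → lift tt
decompose V? ⊥′ = unsatisfiable-decomposition λ _ _ _ _ ()
decompose V? (φ ∧′ ψ) = ∧-decomposition (decompose V? φ) (decompose V? ψ)
decompose V? (¬′ φ) = ¬-decomposition (decompose V? φ)
decompose V? (∃ᵢ x φ) = ∃ᵢ-decomposition x (decompose (V? ∪? (_≟ x)) φ) (decompose (V? ∩? ∁? (_≟ x)) φ)
decompose V? (∃ₚ X φ) = ∃ₚ-decomposition X (decompose V? φ)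

lemma4p13 : (ψ : Formula) (z : ℕ) (V : Pred ℕ 0ℓ) → Decidable V → V z →
    Σ ℕ λ N → Σ (Fin N → Formula) λ L → Σ (Fin N → Formula) λ R →
      (∀ j x → x ∈ FVi (L j) → x ∈ FVi ψ × V x) ×
      (∀ j x → x ∈ FVi (R j) → x ∈ FVi ψ × ¬ V x) ×
      (ExcludedMiddle (lsuc 0ℓ) → z ∈ FVi ψ →
        ∀ (n : ℕ) (σ : ℕ → ℕ) (ρ : ℕ → Pred ℕ 0ℓ) → σ z ≡ n →
        (∀ x → x ∈ FVi ψ → V x → σ x ≤ n) →
        (∀ x → x ∈ FVi ψ → ¬ V x → n < σ x) →
        (Sat everything σ ρ ψ ⇔
          Σ (Fin N) λ j → Sat (λ a → a ≤ n) σ ρ (L j) × Sat (λ a → n < a) σ ρ (R j)))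
lemma4p13 ψ _ V V? _ =
  length pairs , proj₁ ∘ lookup pairs , proj₂ ∘ lookup pairs ,
  (λ j _ → Separated.left (All.lookup separated (∈-lookup j))) ,
  (λ j _ → Separated.right (All.lookup separated (∈-lookup j))) ,
  λ em _ n σ ρ _ below above →
    ⇔-trans (correct em n σ ρ (λ m → below _ m , above _ m)) (Any⇔∃-lookup pairs)
  where open Decomposition (decompose V? ψ)
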